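{- For integers $n$ and $m$, let $C^{H}(n,m)$ be the number of vertically constrained $S_{CW}$ paths from $(0,0)$ to $(n,m)$ (no height restriction, first step arbitrary), with $C^{H}(p,m)=0$ for $p<0$. Then $C^{H}(0,m)=1$ if $m\in\{ -2,0,2\}$ and $0$ otherwise, and for $n\ge1$, $$C^{H}(n,m)=C^{H}(n-1,m+3)+C^{H}(n-2,m+2)+2C^{H}(n-1,m+1)+C^{H}(n-2,m)+2C^{H}(n-1,m-1)+C^{H}(n-2,m-2)+C^{H}(n-1,m-3).$$
   Context: A lattice path is a finite sequence of steps (vectors in $\mathbb{Z}^2$) starting at $(0,0)$; its vertices are the partial sums, and it terminates at the last vertex (the empty path terminates at $(0,0)$). Let $S_C=\{(1,1),(1,-1),(2,0)\}$ and $S_{CW}=S_C\cup\{(0,2),(0,-2)\}$; $(0,\pm2)$ are vertical steps. A vertically constrained $S_{CW}$ path is a lattice path with steps in $S_{CW}$ in which no two consecutive steps are both vertical. -}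

module Defs where

open import Data.Integer using (ℤ; +_; -[1+_]; _+_; _-_; -_; _≤_)
open import Data.Nat using (ℕ)
open import Data.List using (List; []; _∷_)
open import Data.Product using (Σ; _×_; _,_)
open import Data.Unit using (⊤)
open import Data.Empty using (⊥)
open import Data.Fin using (Fin)
open import Function.Bundles using (_↔_)
open import Relation.Nullary using (¬_)
open import Relation.Binary.PropositionalEquality using (_≡_)

data Step : Set where
  up   : Step
  down : Step
  flat : Step
  vup  : Step
  vdn  : Step

vec : Step → ℤ × ℤ
vec up   = (+ 1 , + 1)
vec down = (+ 1 , -[1+ 0 ])
vec flat = (+ 2 , + 0)
vec vup  = (+ 0 , + 2)
vec vdn  = (+ 0 , -[1+ 1 ])

Vertical : Step → Set
Vertical vup = ⊤
Vertical vdn = ⊤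
Vertical _   = ⊥

endpoint : List Step → ℤ × ℤ
endpoint [] = (+ 0 , + 0)
endpoint (s ∷ ss) with vec s | endpoint ss
... | (a , b) | (c , d) = (a + c , b + d)

VertConstrained : List Step → Set
VertConstrained [] = ⊤
VertConstrained (s ∷ []) = ⊤
VertConstrained (s ∷ t ∷ r) = ¬ (Vertical s × Vertical t) × VertConstrained (t ∷ r)

PathsTo : ℤ → ℤ → Set
PathsTo n m = Σ (List Step) (λ p → VertConstrained p × endpoint p ≡ (n , m))

IsPathCount : (ℤ → ℤ → ℕ) → Set
IsPathCount C = ∀ n m → Fin (C n m) ↔ PathsTo n m

-- A vertically constrained path either starts horizontally, or is a vertical step
-- (0, ±2) followed by a path that starts horizontally; a path that starts horizontally
-- is either empty or a step (1, ±1) or (2, 0) followed by an arbitrary vertically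
-- constrained path. Counting both sides of these two bijections expresses column n of
-- the counts through columns n - 1 and n - 2; the resulting nine-term sum regroups
-- into the stated recurrence. Paths never move left, so columns n < 0 are empty, and
-- any two counting functions agree because Fin a ↔ Fin b forces a ≡ b.

module Submission where

open import Defs
open import Data.Integer using (ℤ; +_; -[1+_]; _+_; _-_; _≤_; _<_)
open import Data.Nat using (ℕ) renaming (_+_ to _+ℕ_; _*_ to _*ℕ_)
open import Data.Product using (Σ; _×_; _,_)
open import Data.Sum using (_⊎_)
open import Relation.Nullary using (¬_)
open import Relation.Binary.PropositionalEquality using (_≡_)

open import Axiom.UniquenessOfIdentityProofs.WithK using (uip)
open import Data.Empty using (⊥-elim)
open import Data.Fin using (Fin) renaming (zero to fzero; suc to fsuc)
open import Data.Fin.Permutation using (↔⇒≡)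
open import Data.Fin.Properties using (+↔⊎)
open import Data.Integer using (+≤+; -<+)
import Data.Integer.Properties as ℤ
import Data.Integer.Tactic.RingSolver as ℤ-Solver
open import Data.List using (List; []; _∷_)
open import Data.Nat using (suc; z≤n)
open import Data.Nat.Tactic.RingSolver using (solve-∀)
open import Data.Product using (proj₁; proj₂)
open import Data.Product.Properties using (Σ-≡,≡→≡)
open import Data.Sum using (inj₁; inj₂)
open import Data.Sum.Function.Propositional using (_⊎-↔_)
open import Data.Unit using (⊤; tt)
open import Function using (id; const; _∘_)
open import Function.Bundles using (_↔_; mk↔ₛ′)
open import Function.Properties.Inverse using (↔-sym; ↔-trans)
open import Relation.Nullary using (Irrelevant)
open import Relation.Binary.PropositionalEquality
  using (refl; sym; trans; cong; cong₂; subst)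

i+j≡k⇒j≡k-i : ∀ {i j k} → i + j ≡ k → j ≡ k - i
i+j≡k⇒j≡k-i {i} {j} refl = sym (i+j-i≡j i j)
  where
  i+j-i≡j : ∀ i j → i + j - i ≡ j
  i+j-i≡j = ℤ-Solver.solve-∀

j≡k-i⇒i+j≡k : ∀ {i j k} → j ≡ k - i → i + j ≡ k
j≡k-i⇒i+j≡k {i} {k = k} refl = i+[k-i]≡k i k
  where
  i+[k-i]≡k : ∀ i k → i + (k - i) ≡ k
  i+[k-i]≡k = ℤ-Solver.solve-∀

Fin0-↔ : ∀ {A : Set} → ¬ A → Fin 0 ↔ A
Fin0-↔ ¬a = mk↔ₛ′ (λ ()) (⊥-elim ∘ ¬a) (⊥-elim ∘ ¬a) (λ ())

Fin-+-↔ : ∀ {a b} {A B : Set} → Fin a ↔ A → Fin b ↔ B → Fin (a +ℕ b) ↔ (A ⊎ B)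
Fin-+-↔ a↔A b↔B = ↔-trans +↔⊎ (a↔A ⊎-↔ b↔B)

StartsHorizontally : List Step → Set
StartsHorizontally []      = ⊤
StartsHorizontally (s ∷ _) = ¬ Vertical s

PathsToₕ : ℤ → ℤ → Set
PathsToₕ n m = Σ (PathsTo n m) (StartsHorizontally ∘ proj₁)

VertConstrained-uncons : ∀ {s} p → VertConstrained (s ∷ p) →
                         (Vertical s → StartsHorizontally p) × VertConstrained p
VertConstrained-uncons []      _               = const tt , tt
VertConstrained-uncons (_ ∷ _) (¬vertical , v) = (λ vs vt → ¬vertical (vs , vt)) , v

VertConstrained-cons : ∀ {s} p → (Vertical s → StartsHorizontally p) →
                       VertConstrained p → VertConstrained (s ∷ p)
VertConstrained-cons []      _          _ = tt
VertConstrained-cons (_ ∷ _) horizontal v = (λ (vs , vt) → horizontal vs vt) , v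

VertConstrained-irrelevant : ∀ p → Irrelevant (VertConstrained p)
VertConstrained-irrelevant []          _       _       = refl
VertConstrained-irrelevant (_ ∷ [])    _       _       = refl
VertConstrained-irrelevant (_ ∷ t ∷ r) (_ , v) (_ , w) =
  cong (_ ,_) (VertConstrained-irrelevant (t ∷ r) v w)

StartsHorizontally-irrelevant : ∀ p → Irrelevant (StartsHorizontally p)
StartsHorizontally-irrelevant []      _ _ = refl
StartsHorizontally-irrelevant (_ ∷ _) _ _ = refl

PathsTo-≡ : ∀ {n m} {x y : PathsTo n m} → proj₁ x ≡ proj₁ y → x ≡ y
PathsTo-≡ {x = p , v , e} {y = .p , w , f} refl =
  cong₂ (λ v e → p , v , e) (VertConstrained-irrelevant p v w) (uip e f)

PathsToₕ-≡ : ∀ {n m} {x y : PathsToₕ n m} → proj₁ (proj₁ x) ≡ proj₁ (proj₁ y) → x ≡ y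
PathsToₕ-≡ {x = x , h} {y = y , k} eq =
  Σ-≡,≡→≡ (PathsTo-≡ eq , StartsHorizontally-irrelevant (proj₁ y) _ k)

module _ (s : Step) {n m n′ m′ : ℤ}
         (n′≡ : n′ ≡ n - proj₁ (vec s)) (m′≡ : m′ ≡ m - proj₂ (vec s)) where

  endpoint-uncons : ∀ p → endpoint (s ∷ p) ≡ (n , m) → endpoint p ≡ (n′ , m′)
  endpoint-uncons p e = cong₂ _,_
    (trans (i+j≡k⇒j≡k-i (cong proj₁ e)) (sym n′≡))
    (trans (i+j≡k⇒j≡k-i (cong proj₂ e)) (sym m′≡))

  endpoint-cons : ∀ p → endpoint p ≡ (n′ , m′) → endpoint (s ∷ p) ≡ (n , m)
  endpoint-cons p e = cong₂ _,_
    (j≡k-i⇒i+j≡k (trans (cong proj₁ e) n′≡))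
    (j≡k-i⇒i+j≡k (trans (cong proj₂ e) m′≡))

  tailPath : ∀ {p} → VertConstrained (s ∷ p) → endpoint (s ∷ p) ≡ (n , m) → PathsTo n′ m′
  tailPath {p} v e = p , proj₂ (VertConstrained-uncons p v) , endpoint-uncons p e

  consPath : (x : PathsTo n′ m′) → (Vertical s → StartsHorizontally (proj₁ x)) → PathsTo n m
  consPath (p , v , e) h = s ∷ p , VertConstrained-cons p h v , endpoint-cons p e

PathsTo-↔ : ∀ {n m} →
  PathsTo n m ↔ (PathsToₕ n m ⊎ (PathsToₕ n (m - + 2) ⊎ PathsToₕ n (m + + 2)))
PathsTo-↔ {n} {m} = mk↔ₛ′ to from to∘from from∘to
  where
  n≡n-0 : n ≡ n - + 0
  n≡n-0 = sym (ℤ.+-identityʳ n)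

  to : PathsTo n m → PathsToₕ n m ⊎ (PathsToₕ n (m - + 2) ⊎ PathsToₕ n (m + + 2))
  to x@([] , _)        = inj₁ (x , tt)
  to x@(up ∷ _ , _)    = inj₁ (x , id)
  to x@(down ∷ _ , _)  = inj₁ (x , id)
  to x@(flat ∷ _ , _)  = inj₁ (x , id)
  to (vup ∷ p , v , e) =
    inj₂ (inj₁ (tailPath vup n≡n-0 refl v e , proj₁ (VertConstrained-uncons p v) tt))
  to (vdn ∷ p , v , e) =
    inj₂ (inj₂ (tailPath vdn n≡n-0 refl v e , proj₁ (VertConstrained-uncons p v) tt))

  from : PathsToₕ n m ⊎ (PathsToₕ n (m - + 2) ⊎ PathsToₕ n (m + + 2)) → PathsTo n m
  from (inj₁ (x , _))        = x
  from (inj₂ (inj₁ (x , h))) = consPath vup n≡n-0 refl x (const h)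
  from (inj₂ (inj₂ (x , h))) = consPath vdn n≡n-0 refl x (const h)

  to∘from : ∀ y → to (from y) ≡ y
  to∘from (inj₁ (([] , _) , _))       = refl
  to∘from (inj₁ ((up ∷ _ , _) , _))   = refl
  to∘from (inj₁ ((down ∷ _ , _) , _)) = refl
  to∘from (inj₁ ((flat ∷ _ , _) , _)) = refl
  to∘from (inj₁ ((vup ∷ _ , _) , h))  = ⊥-elim (h tt)
  to∘from (inj₁ ((vdn ∷ _ , _) , h))  = ⊥-elim (h tt)
  to∘from (inj₂ (inj₁ _))             = cong (inj₂ ∘ inj₁) (PathsToₕ-≡ refl)
  to∘from (inj₂ (inj₂ _))             = cong (inj₂ ∘ inj₂) (PathsToₕ-≡ refl)

  from∘to : ∀ x → from (to x) ≡ x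
  from∘to ([] , _)       = refl
  from∘to (up ∷ _ , _)   = refl
  from∘to (down ∷ _ , _) = refl
  from∘to (flat ∷ _ , _) = refl
  from∘to (vup ∷ _ , _)  = PathsTo-≡ refl
  from∘to (vdn ∷ _ , _)  = PathsTo-≡ refl

PathsToₕ-↔ : ∀ {n m} → PathsToₕ n m ↔
  (PathsTo (n - + 1) (m - + 1) ⊎ (PathsTo (n - + 1) (m + + 1) ⊎
    (PathsTo (n - + 2) m ⊎ (+ 0 , + 0) ≡ (n , m))))
PathsToₕ-↔ {n} {m} = mk↔ₛ′ to from to∘from from∘to
  where
  m≡m-0 : m ≡ m - + 0
  m≡m-0 = sym (ℤ.+-identityʳ m)

  to : PathsToₕ n m → PathsTo (n - + 1) (m - + 1) ⊎ (PathsTo (n - + 1) (m + + 1) ⊎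
                       (PathsTo (n - + 2) m ⊎ (+ 0 , + 0) ≡ (n , m)))
  to (([] , _ , e) , _)        = inj₂ (inj₂ (inj₂ e))
  to ((up ∷ _ , v , e) , _)    = inj₁ (tailPath up refl refl v e)
  to ((down ∷ _ , v , e) , _)  = inj₂ (inj₁ (tailPath down refl refl v e))
  to ((flat ∷ _ , v , e) , _)  = inj₂ (inj₂ (inj₁ (tailPath flat refl m≡m-0 v e)))
  to ((vup ∷ _ , _) , h)       = ⊥-elim (h tt)
  to ((vdn ∷ _ , _) , h)       = ⊥-elim (h tt)

  from : PathsTo (n - + 1) (m - + 1) ⊎ (PathsTo (n - + 1) (m + + 1) ⊎
           (PathsTo (n - + 2) m ⊎ (+ 0 , + 0) ≡ (n , m))) → PathsToₕ n m
  from (inj₁ x)                = consPath up refl refl x ⊥-elim , id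
  from (inj₂ (inj₁ x))         = consPath down refl refl x ⊥-elim , id
  from (inj₂ (inj₂ (inj₁ x)))  = consPath flat refl m≡m-0 x ⊥-elim , id
  from (inj₂ (inj₂ (inj₂ e)))  = ([] , tt , e) , tt

  to∘from : ∀ y → to (from y) ≡ y
  to∘from (inj₁ _)               = cong inj₁ (PathsTo-≡ refl)
  to∘from (inj₂ (inj₁ _))        = cong (inj₂ ∘ inj₁) (PathsTo-≡ refl)
  to∘from (inj₂ (inj₂ (inj₁ _))) = cong (inj₂ ∘ inj₂ ∘ inj₁) (PathsTo-≡ refl)
  to∘from (inj₂ (inj₂ (inj₂ _))) = refl

  from∘to : ∀ x → from (to x) ≡ x
  from∘to (([] , _) , _)       = refl
  from∘to ((up ∷ _ , _) , _)   = PathsToₕ-≡ refl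
  from∘to ((down ∷ _ , _) , _) = PathsToₕ-≡ refl
  from∘to ((flat ∷ _ , _) , _) = PathsToₕ-≡ refl
  from∘to ((vup ∷ _ , _) , h)  = ⊥-elim (h tt)
  from∘to ((vdn ∷ _ , _) , h)  = ⊥-elim (h tt)

step-x-nonnegative : ∀ s → + 0 ≤ proj₁ (vec s)
step-x-nonnegative up   = +≤+ z≤n
step-x-nonnegative down = +≤+ z≤n
step-x-nonnegative flat = +≤+ z≤n
step-x-nonnegative vup  = +≤+ z≤n
step-x-nonnegative vdn  = +≤+ z≤n

endpoint-x-nonnegative : ∀ p → + 0 ≤ proj₁ (endpoint p)
endpoint-x-nonnegative []      = ℤ.≤-refl
endpoint-x-nonnegative (s ∷ p) = ℤ.+-mono-≤ (step-x-nonnegative s) (endpoint-x-nonnegative p)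

PathsTo-negative : ∀ {n m} → n < + 0 → ¬ PathsTo n m
PathsTo-negative n<0 (p , _ , e) =
  ℤ.<⇒≱ n<0 (subst (+ 0 ≤_) (cong proj₁ e) (endpoint-x-nonnegative p))

originIndicator : ℤ → ℤ → ℕ
originIndicator (+ 0) (+ 0) = 1
originIndicator _     _     = 0

Fin-originIndicator-↔ : ∀ n m → Fin (originIndicator n m) ↔ ((+ 0 , + 0) ≡ (n , m))
Fin-originIndicator-↔ (+ 0)     (+ 0)     =
  mk↔ₛ′ (const refl) (const fzero) (λ _ → uip _ _) λ { fzero → refl; (fsuc ()) }
Fin-originIndicator-↔ (+ 0)     (+ suc _) = Fin0-↔ λ ()
Fin-originIndicator-↔ (+ 0)     -[1+ _ ]  = Fin0-↔ λ ()
Fin-originIndicator-↔ (+ suc _) _         = Fin0-↔ λ ()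
Fin-originIndicator-↔ -[1+ _ ]  _         = Fin0-↔ λ ()

-- f and g are the counts of columns n - 1 and n - 2, and o indicates the origin in column n.
horizontalCount : (ℤ → ℕ) → (ℤ → ℕ) → (ℤ → ℕ) → ℤ → ℕ
horizontalCount f g o m = f (m - + 1) +ℕ (f (m + + 1) +ℕ (g m +ℕ o m))

columnCount : (ℤ → ℕ) → (ℤ → ℕ) → (ℤ → ℕ) → ℤ → ℕ
columnCount f g o m = h m +ℕ (h (m - + 2) +ℕ h (m + + 2))
  where h = horizontalCount f g o

Fin-columnCount-↔ : ∀ {n} {f g o : ℤ → ℕ} →
  (∀ m → Fin (f m) ↔ PathsTo (n - + 1) m) →
  (∀ m → Fin (g m) ↔ PathsTo (n - + 2) m) →
  (∀ m → Fin (o m) ↔ ((+ 0 , + 0) ≡ (n , m))) →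
  ∀ m → Fin (columnCount f g o m) ↔ PathsTo n m
Fin-columnCount-↔ {n} {f} {g} {o} F G O m =
  ↔-trans (Fin-+-↔ (H m) (Fin-+-↔ (H (m - + 2)) (H (m + + 2)))) (↔-sym PathsTo-↔)
  where
  H : ∀ m → Fin (horizontalCount f g o m) ↔ PathsToₕ n m
  H m = ↔-trans (Fin-+-↔ (F (m - + 1)) (Fin-+-↔ (F (m + + 1)) (Fin-+-↔ (G m) (O m))))
                (↔-sym PathsToₕ-↔)

column : ℕ → ℤ → ℕ
column 0             = columnCount (const 0) (const 0) (originIndicator (+ 0))
column 1             = columnCount (column 0) (const 0) (originIndicator (+ 1))
column (suc (suc k)) = columnCount (column (suc k)) (column k) (originIndicator (+ suc (suc k)))

pathCount : ℤ → ℤ → ℕ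
pathCount (+ k)    = column k
pathCount -[1+ _ ] = const 0

Fin0-↔-PathsTo-negative : ∀ k m → Fin 0 ↔ PathsTo -[1+ k ] m
Fin0-↔-PathsTo-negative _ _ = Fin0-↔ (PathsTo-negative -<+)

pathCount-↔ : IsPathCount pathCount
pathCount-↔ -[1+ k ] = Fin0-↔-PathsTo-negative k
pathCount-↔ (+ 0) =
  Fin-columnCount-↔ (Fin0-↔-PathsTo-negative 0) (Fin0-↔-PathsTo-negative 1) (Fin-originIndicator-↔ _)
pathCount-↔ (+ 1) =
  Fin-columnCount-↔ (pathCount-↔ (+ 0)) (Fin0-↔-PathsTo-negative 0) (Fin-originIndicator-↔ _)
pathCount-↔ (+ suc (suc k)) =
  Fin-columnCount-↔ (pathCount-↔ (+ suc k)) (pathCount-↔ (+ k)) (Fin-originIndicator-↔ _)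

count-unique : ∀ {C D} → IsPathCount C → IsPathCount D → ∀ n m → C n m ≡ D n m
count-unique C↔ D↔ n m = ↔⇒≡ (↔-trans (C↔ n m) (↔-sym (D↔ n m)))

count-negative : ∀ {C n m} → IsPathCount C → n < + 0 → C n m ≡ 0
count-negative {n = n} {m} C↔ n<0 =
  ↔⇒≡ (↔-trans (C↔ n m) (↔-sym (Fin0-↔ (PathsTo-negative n<0))))

not-origin : ∀ {n m : ℤ} → + 1 ≤ n → ¬ ((+ 0 , + 0) ≡ (n , m))
not-origin (+≤+ ()) refl

count-columnCount : ∀ {C n m} → IsPathCount C → + 1 ≤ n →
                    C n m ≡ columnCount (C (n - + 1)) (C (n - + 2)) (const 0) m
count-columnCount {C} {n} {m} C↔ 1≤n = ↔⇒≡ (↔-trans (C↔ n m)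
  (↔-sym (Fin-columnCount-↔ (C↔ (n - + 1)) (C↔ (n - + 2))
                            (λ _ → Fin0-↔ (not-origin 1≤n)) m)))

horizontalCount-+ : ∀ f g o m k → horizontalCount f g o (m + k) ≡
                    f (m + (k - + 1)) +ℕ (f (m + (k + + 1)) +ℕ (g (m + k) +ℕ o (m + k)))
horizontalCount-+ f g o m k =
  cong₂ (λ i j → f i +ℕ (f j +ℕ (g (m + k) +ℕ o (m + k))))
        (ℤ.+-assoc m k -[1+ 0 ]) (ℤ.+-assoc m k (+ 1))

columnCount-recurrence : ∀ f g m → columnCount f g (const 0) m ≡
  f (m + + 3) +ℕ g (m + + 2) +ℕ 2 *ℕ f (m + + 1) +ℕ g m
    +ℕ 2 *ℕ f (m - + 1) +ℕ g (m - + 2) +ℕ f (m - + 3)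
columnCount-recurrence f g m = trans
  (cong₂ (λ below above → horizontalCount f g (const 0) m +ℕ (below +ℕ above))
         (horizontalCount-+ f g (const 0) m -[1+ 1 ])
         (horizontalCount-+ f g (const 0) m (+ 2)))
  (regroup (f (m + + 3)) (g (m + + 2)) (f (m + + 1)) (g m) (f (m - + 1)) (g (m - + 2)) (f (m - + 3)))
  where
  regroup : ∀ a b c d e f g →
    (e +ℕ (c +ℕ (d +ℕ 0))) +ℕ ((g +ℕ (e +ℕ (f +ℕ 0))) +ℕ (c +ℕ (a +ℕ (b +ℕ 0))))
      ≡ a +ℕ b +ℕ 2 *ℕ c +ℕ d +ℕ 2 *ℕ e +ℕ f +ℕ g
  regroup = solve-∀

pathCount-0-∈ : ∀ m → (m ≡ -[1+ 1 ] ⊎ m ≡ + 0 ⊎ m ≡ + 2) → pathCount (+ 0) m ≡ 1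
pathCount-0-∈ _ (inj₁ refl)        = refl
pathCount-0-∈ _ (inj₂ (inj₁ refl)) = refl
pathCount-0-∈ _ (inj₂ (inj₂ refl)) = refl

pathCount-0-∉ : ∀ m → ¬ (m ≡ -[1+ 1 ] ⊎ m ≡ + 0 ⊎ m ≡ + 2) → pathCount (+ 0) m ≡ 0
pathCount-0-∉ (+ 0)                 m∉ = ⊥-elim (m∉ (inj₂ (inj₁ refl)))
pathCount-0-∉ (+ 1)                 _  = refl
pathCount-0-∉ (+ 2)                 m∉ = ⊥-elim (m∉ (inj₂ (inj₂ refl)))
pathCount-0-∉ (+ suc (suc (suc _))) _  = refl
pathCount-0-∉ -[1+ 0 ]              _  = refl
pathCount-0-∉ -[1+ 1 ]              m∉ = ⊥-elim (m∉ (inj₁ refl))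
pathCount-0-∉ -[1+ suc (suc _) ]    _  = refl

lemma19 : Σ (ℤ → ℤ → ℕ) IsPathCount
    × (∀ (C : ℤ → ℤ → ℕ) → IsPathCount C →
        (∀ p m → p < + 0 → C p m ≡ 0)
        × (∀ m → (m ≡ -[1+ 1 ] ⊎ m ≡ + 0 ⊎ m ≡ + 2) → C (+ 0) m ≡ 1)
        × (∀ m → ¬ (m ≡ -[1+ 1 ] ⊎ m ≡ + 0 ⊎ m ≡ + 2) → C (+ 0) m ≡ 0)
        × (∀ n m → + 1 ≤ n →
            C n m ≡ C (n - + 1) (m + + 3) +ℕ C (n - + 2) (m + + 2)
                    +ℕ 2 *ℕ C (n - + 1) (m + + 1) +ℕ C (n - + 2) m
                    +ℕ 2 *ℕ C (n - + 1) (m - + 1) +ℕ C (n - + 2) (m - + 2)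
                    +ℕ C (n - + 1) (m - + 3)))
lemma19 = (pathCount , pathCount-↔) , λ C C↔ →
    (λ _ _ → count-negative C↔)
  , (λ m m∈ → trans (count-unique C↔ pathCount-↔ (+ 0) m) (pathCount-0-∈ m m∈))
  , (λ m m∉ → trans (count-unique C↔ pathCount-↔ (+ 0) m) (pathCount-0-∉ m m∉))
  , (λ n m 1≤n → trans (count-columnCount C↔ 1≤n)
                       (columnCount-recurrence (C (n - + 1)) (C (n - + 2)) m))
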